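{- Let $p\equiv 1\pmod 6$ be a prime and $a\in\mathbb{F}_p^*$. Let $N_{p,a}$ be the number of $\mathbb{F}_p$-rational points (including the point at infinity) of the elliptic curve $y^{2}=x^{3}+a^{3}$ over $\mathbb{F}_p$. Then $a\in Q_p$ if and only if $N_{p,a}\equiv 0\pmod 6$.
   Context: $Q_p$ denotes the set of quadratic residues modulo $p$, i.e. the nonzero squares in $\mathbb{F}_p$. -}

module Defs where

open import Data.Nat using (ℕ; zero; suc; _+_; _*_; _<_; _≟_; NonZero)
open import Data.Nat.DivMod using (_%_)
open import Data.List using (List; length; filter; upTo; cartesianProduct)
open import Data.Product using (_×_; _,_; ∃-syntax)
open import Relation.Binary.PropositionalEquality using (_≡_; _≢_)

-- Elements of 𝔽_p are represented by the residues 0, 1, …, p-1 (natural numbers < p),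
-- with arithmetic taken modulo p.

affinePoints : (p c : ℕ) .{{_ : NonZero p}} → List (ℕ × ℕ)
affinePoints p c =
  filter (λ { (x , y) → (y * y) % p ≟ (x * x * x + c) % p })
         (cartesianProduct (upTo p) (upTo p))

-- N_{p,a}: number of 𝔽_p-rational points of y² = x³ + a³, including the point at infinity.
N : (p a : ℕ) .{{_ : NonZero p}} → ℕ
N p a = suc (length (affinePoints p (a * a * a)))

IsQR : (p a : ℕ) .{{_ : NonZero p}} → Set
IsQR p a = (a % p ≢ 0) × ∃[ b ] ((b * b) % p ≡ a % p)

-- If a map σ on a finite set satisfies σ^ℓ = id for a prime ℓ, then every orbit has 1 or ℓ
-- elements, so the set has as many elements as σ has fixed points, modulo ℓ.
--
-- Mod 2: the negation (x , y) ↦ (x , −y) shows that the number of affine points is congruent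
-- to the number of roots of x³ + a³, and x ↦ −x²/a is an involution of these roots whose only
-- fixed point is −a. Hence N_{p,a} is even.
--
-- Mod 3: since 3 ∣ p − 1 there is a cube root of unity ω ≠ 1, and (x , y) ↦ (ω x , y) has
-- order 3 with fixed points the affine points (0 , y), y² = a³. There are two of them, (0 , ±ab),
-- when a = b², and none otherwise, since y² = a³ gives a = (y/a)². So 3 ∣ N_{p,a} iff a ∈ Q_p.
module Submission where

open import Defs
open import Data.Nat using (ℕ; suc; _%_; NonZero)
open import Data.Nat.Primality using (Prime)
open import Data.Product using (_×_)
open import Relation.Binary.PropositionalEquality using (_≡_; _≢_)

open import Data.Empty using (⊥-elim)
open import Data.Fin using (Fin; toℕ; fromℕ<)
open import Data.Fin.Properties using (toℕ-fromℕ<; toℕ-injective; toℕ<n)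
open import Data.List using (List; []; _∷_; length; filter; tabulate; map; upTo; cartesianProduct)
open import Data.List.Properties using (length-tabulate; length-map; length-upTo; length-++)
open import Data.List.Membership.Propositional using (_∈_)
open import Data.List.Membership.Propositional.Properties
  using ( ∈-filter⁺; ∈-filter⁻; ∈-tabulate⁺; ∈-tabulate⁻; ∈-map⁺; ∈-map⁻; ∈-upTo⁺; ∈-upTo⁻
        ; ∈-cartesianProduct⁺; ∈-cartesianProduct⁻)
open import Data.List.Membership.Propositional.Properties.WithK using (unique∧set⇒bag)
import Data.List.Membership.DecPropositional as DecMembership
open import Data.List.Relation.Binary.BagAndSetEquality using (∼bag⇒↭)
open import Data.List.Relation.Binary.Permutation.Propositional.Properties using (↭-length)
open import Data.List.Relation.Unary.All using ([]; _∷_)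
open import Data.List.Relation.Unary.Any using (here; there)
open import Data.List.Relation.Unary.Unique.Propositional using (Unique; []; _∷_)
open import Data.List.Relation.Unary.Unique.Propositional.Properties
  using (filter⁺; tabulate⁺; map⁺; upTo⁺; cartesianProduct⁺)
open import Data.Nat
  using (_≟_; zero; _+_; _*_; _∸_; _<_; _≤_; z≤n; s≤s; pred; >-nonZero; >-nonZero⁻¹; nonTrivial⇒n>1)
open import Data.Nat.Coprimality using (coprime-Bézout; prime⇒coprime)
open import Data.Nat.DivMod
  using ( _/_; m≡m%n+[m/n]*n; m%n<n; m%n%n≡m%n; [m+kn]%n≡m%n; m<n⇒m%n≡m; %-distribˡ-+; %-distribˡ-*
        ; m∣n⇒o%n%m≡o%m)
open import Data.Nat.Divisibility
  using ( _∣_; divides; _∣0; n∣n; ∣-trans; m∣m*n; n∣m*n; ∣1⇒≡1; ∣m+n∣m⇒∣n; ∣m∣n⇒∣m+n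
        ; m%n≡0⇒n∣m; n∣m⇒m%n≡0)
open import Data.Nat.GCD using (module Bézout; module GCD; GCD)
open import Data.Nat.GeneralisedArithmetic using (fold; fold-+)
open import Data.Nat.Induction using (<-wellFounded)
open import Data.Nat.LCM using (lcm-least)
open import Data.Nat.Primality
  using (prime[2]; prime?; prime⇒nonZero; prime⇒nonTrivial; prime⇒irreducible; euclidsLemma)
open import Data.Nat.Properties
open import Data.Nat.Tactic.RingSolver using (solve-∀)
open import Data.Product using (_,_; proj₁; proj₂; ∃-syntax)
open import Data.Product.Properties using (≡-dec)
open import Data.Sum using (_⊎_; inj₁; inj₂; [_,_]′)
open import Function.Base using (_∘_)
open import Function.Bundles using (mk⇔)
open import Induction.WellFounded using (Acc; acc)
open import Level using (0ℓ)
open import Relation.Binary.Bundles using (Setoid)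
import Relation.Binary.Construct.On as On
open import Relation.Binary.Definitions using (DecidableEquality; tri<; tri≈; tri>)
import Relation.Binary.PropositionalEquality as ≡
open import Relation.Binary.PropositionalEquality using (refl; sym; trans; cong; cong₂; subst; module ≡-Reasoning)
import Relation.Binary.Reasoning.Setoid as SetoidReasoning
open import Relation.Nullary using (¬_; yes; no)
open import Relation.Nullary.Decidable using (from-yes)
open import Relation.Unary using (Pred; Decidable)
open import Relation.Unary.Properties using (∁?)

module _ {A : Set} where

  length-filter+length-filter-∁ : ∀ {ℓ} {P : Pred A ℓ} (P? : Decidable P) xs →
    length (filter P? xs) + length (filter (∁? P?) xs) ≡ length xs
  length-filter+length-filter-∁ P? [] = refl
  length-filter+length-filter-∁ P? (x ∷ xs) with P? x
  ... | yes _ = cong suc (length-filter+length-filter-∁ P? xs)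
  ... | no _  = trans (+-suc _ _) (cong suc (length-filter+length-filter-∁ P? xs))

  -- Two duplicate-free lists with the same elements are permutations of each other.
  length-filter≡length : ∀ {ℓ} {P : Pred A ℓ} (P? : Decidable P) {xs ys : List A} → Unique xs → Unique ys →
    (∀ {z} → z ∈ ys → z ∈ xs × P z) → (∀ {z} → z ∈ xs → P z → z ∈ ys) →
    length (filter P? xs) ≡ length ys
  length-filter≡length P? {xs} {ys} xs! ys! ys⊆ ⊆ys =
    ↭-length (∼bag⇒↭ (unique∧set⇒bag (filter⁺ P? xs!) ys! (mk⇔ to from)))
    where
    to : ∀ {z} → z ∈ filter P? xs → z ∈ ys
    to z∈ = let z∈xs , Pz = ∈-filter⁻ P? z∈ in ⊆ys z∈xs Pz
    from : ∀ {z} → z ∈ ys → z ∈ filter P? xs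
    from z∈ = let z∈xs , Pz = ys⊆ z∈ in ∈-filter⁺ P? z∈xs Pz

  ∈-nonempty : ∀ {xs : List A} → length xs ≢ 0 → ∃[ z ] z ∈ xs
  ∈-nonempty {[]} length≢0 = ⊥-elim (length≢0 refl)
  ∈-nonempty {z ∷ _} _ = z , here refl

length-cartesianProduct : ∀ {A B : Set} (xs : List A) (ys : List B) →
  length (cartesianProduct xs ys) ≡ length xs * length ys
length-cartesianProduct [] ys = refl
length-cartesianProduct (x ∷ xs) ys =
  trans (length-++ (map (x ,_) ys)) (cong₂ _+_ (length-map (x ,_) ys) (length-cartesianProduct xs ys))

_≟²_ : DecidableEquality (ℕ × ℕ)
_≟²_ = ≡-dec _≟_ _≟_

n∤1+k*n : ∀ {n} k → 1 < n → ¬ (n ∣ 1 + k * n)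
n∤1+k*n {n} k 1<n n∣1+kn =
  <⇒≢ 1<n (sym (∣1⇒≡1 (∣m+n∣m⇒∣n (subst (n ∣_) (+-comm 1 (k * n)) n∣1+kn) (n∣m*n k))))

p%6≡1⇒p%3≡1 : ∀ {p} → p % 6 ≡ 1 → p % 3 ≡ 1
p%6≡1⇒p%3≡1 {p} p%6≡1 = trans (sym (m∣n⇒o%n%m≡o%m 3 6 p (divides 2 refl))) (cong (_% 3) p%6≡1)

6∣⇒%6≡0 : ∀ {n} → 6 ∣ n → n % 6 ≡ 0
6∣⇒%6≡0 {n} = n∣m⇒m%n≡0 n 6

%6≡0⇒3∣ : ∀ {n} → n % 6 ≡ 0 → 3 ∣ n
%6≡0⇒3∣ {n} n%6≡0 = ∣-trans (divides 2 refl) (m%n≡0⇒n∣m n 6 n%6≡0)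

prime[3] : Prime 3
prime[3] = from-yes (prime? 3)

-- Fixed points of maps of prime period

module PrimePeriod {A : Set} (_≟_ : DecidableEquality A) (σ : A → A) where

  open DecMembership _≟_ using (_∈?_)
  open ≡-Reasoning

  σ^ : ℕ → A → A
  σ^ i z = fold z σ i

  σ^-+ : ∀ i j z → σ^ (i + j) z ≡ σ^ i (σ^ j z)
  σ^-+ i j z = fold-+ z σ i

  σ^-comm : ∀ i j z → σ^ i (σ^ j z) ≡ σ^ j (σ^ i z)
  σ^-comm i j z = trans (sym (σ^-+ i j z)) (trans (cong (λ k → σ^ k z) (+-comm i j)) (σ^-+ j i z))

  Fixed : Pred A _
  Fixed z = σ z ≡ z

  fixed? : Decidable Fixed
  fixed? z = σ z ≟ z

  σ^-Fixed : ∀ {z} → Fixed z → ∀ i → σ^ i z ≡ z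
  σ^-Fixed fz zero = refl
  σ^-Fixed fz (suc i) = trans (cong σ (σ^-Fixed fz i)) fz

  σ^-*-periodic : ∀ {j z} → σ^ j z ≡ z → ∀ k → σ^ (k * j) z ≡ z
  σ^-*-periodic e zero = refl
  σ^-*-periodic {j} {z} e (suc k) = begin
    σ^ (j + k * j) z     ≡⟨ σ^-+ j (k * j) z ⟩
    σ^ j (σ^ (k * j) z)  ≡⟨ cong (σ^ j) (σ^-*-periodic e k) ⟩
    σ^ j z               ≡⟨ e ⟩
    z                    ∎

  module _ {n : ℕ} (n-prime : Prime n) where

    private instance
      n≢0 : NonZero n
      n≢0 = prime⇒nonZero n-prime

    Periodic : Pred A _
    Periodic z = σ^ n z ≡ z

    σ^-Periodic : ∀ {z} → Periodic z → ∀ i → Periodic (σ^ i z)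
    σ^-Periodic {z} zn i = trans (σ^-comm n i z) (cong (σ^ i) zn)

    σ^-∸ : ∀ {z i} → Periodic z → i ≤ n → σ^ (n ∸ i) (σ^ i z) ≡ z
    σ^-∸ {z} {i} zn i≤n = begin
      σ^ (n ∸ i) (σ^ i z)  ≡⟨ σ^-+ (n ∸ i) i z ⟨
      σ^ (n ∸ i + i) z     ≡⟨ cong (λ k → σ^ k z) (m∸n+n≡m i≤n) ⟩
      σ^ n z               ≡⟨ zn ⟩
      z                    ∎

    σ^-% : ∀ {z} → Periodic z → ∀ m → σ^ m z ≡ σ^ (m % n) z
    σ^-% {z} zn m = begin
      σ^ m z                              ≡⟨ cong (λ k → σ^ k z) (m≡m%n+[m/n]*n m n) ⟩
      σ^ (m % n + (m / n) * n) z          ≡⟨ σ^-+ (m % n) _ z ⟩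
      σ^ (m % n) (σ^ ((m / n) * n) z)     ≡⟨ cong (σ^ (m % n)) (σ^-*-periodic zn (m / n)) ⟩
      σ^ (m % n) z                        ∎

    -- Since n is prime, any 0 < i < n is a Bézout combination 1 + y i = x n (or 1 + x n = y i).
    periodic⇒fixed : ∀ {i z} → Periodic z → σ^ i z ≡ z → 0 < i → i < n → Fixed z
    periodic⇒fixed {i} {z} zn zi 0<i i<n
      with coprime-Bézout (prime⇒coprime n-prime {{>-nonZero 0<i}} i<n)
    ... | Bézout.+- x y eq = begin
      σ z                ≡⟨ cong σ (σ^-*-periodic zi y) ⟨
      σ^ (1 + y * i) z   ≡⟨ cong (λ k → σ^ k z) eq ⟩
      σ^ (x * n) z       ≡⟨ σ^-*-periodic zn x ⟩
      z                  ∎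
    ... | Bézout.-+ x y eq = begin
      σ z                ≡⟨ cong σ (σ^-*-periodic zn x) ⟨
      σ^ (1 + x * n) z   ≡⟨ cong (λ k → σ^ k z) eq ⟩
      σ^ (y * i) z       ≡⟨ σ^-*-periodic zi y ⟩
      z                  ∎

    1≤n : 1 ≤ n
    1≤n = >-nonZero⁻¹ n

    Fixed-σ⁻ : ∀ {z} → Periodic z → Fixed (σ z) → Fixed z
    Fixed-σ⁻ {z} zn fσz = sym (trans (sym (σ^-∸ zn 1≤n)) (σ^-Fixed fσz (n ∸ 1)))

    orbit : A → List A
    orbit e = tabulate (λ (i : Fin n) → σ^ (toℕ i) e)

    σ^∈orbit : ∀ {e} → Periodic e → ∀ m → σ^ m e ∈ orbit e
    σ^∈orbit {e} en m = subst (_∈ orbit e) same (∈-tabulate⁺ (fromℕ< (m%n<n m n)))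
      where
      same : σ^ (toℕ (fromℕ< (m%n<n m n))) e ≡ σ^ m e
      same = trans (cong (λ k → σ^ k e) (toℕ-fromℕ< (m%n<n m n))) (sym (σ^-% en m))

    ∈-orbit-σ⁻ : ∀ {e z} → Periodic e → Periodic z → σ z ∈ orbit e → z ∈ orbit e
    ∈-orbit-σ⁻ {e} {z} en zn σz∈ with ∈-tabulate⁻ σz∈
    ... | i , σz≡ = subst (_∈ orbit e) same (σ^∈orbit en (n ∸ 1 + toℕ i))
      where
      same : σ^ (n ∸ 1 + toℕ i) e ≡ z
      same = begin
        σ^ (n ∸ 1 + toℕ i) e     ≡⟨ σ^-+ (n ∸ 1) (toℕ i) e ⟩
        σ^ (n ∸ 1) (σ^ (toℕ i) e) ≡⟨ cong (σ^ (n ∸ 1)) σz≡ ⟨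
        σ^ (n ∸ 1) (σ z)          ≡⟨ σ^-∸ zn 1≤n ⟩
        z                         ∎

    orbit-unique : ∀ {e} → Periodic e → ¬ Fixed e → Unique (orbit e)
    orbit-unique {e} en ¬fe = tabulate⁺ (λ {i} {j} eq → toℕ-injective (σ^-injective (toℕ<n i) (toℕ<n j) eq))
      where
      σ^-injective-< : ∀ {i j} → i < j → j < n → σ^ i e ≢ σ^ j e
      σ^-injective-< {i} {j} i<j j<n eq = ¬fe (subst Fixed (sym e≡w) fixed-w)
        where
        w = σ^ i e
        d = j ∸ i
        period-d : σ^ d w ≡ w
        period-d = begin
          σ^ d (σ^ i e)  ≡⟨ σ^-+ d i e ⟨
          σ^ (d + i) e   ≡⟨ cong (λ k → σ^ k e) (m∸n+n≡m (<⇒≤ i<j)) ⟩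
          σ^ j e         ≡⟨ eq ⟨
          w              ∎
        fixed-w : Fixed w
        fixed-w = periodic⇒fixed (σ^-Periodic en i) period-d (m<n⇒0<n∸m i<j) (≤-<-trans (m∸n≤m j i) j<n)
        e≡w : e ≡ w
        e≡w = trans (sym (σ^-∸ en (<⇒≤ (<-trans i<j j<n)))) (σ^-Fixed fixed-w (n ∸ i))
      σ^-injective : ∀ {i j} → i < n → j < n → σ^ i e ≡ σ^ j e → i ≡ j
      σ^-injective {i} {j} i<n j<n eq with <-cmp i j
      ... | tri< i<j _ _ = ⊥-elim (σ^-injective-< i<j j<n eq)
      ... | tri≈ _ i≡j _ = i≡j
      ... | tri> _ _ j<i = ⊥-elim (σ^-injective-< j<i i<n (sym eq))

    record Invariant (L : List A) : Set where
      field
        unique   : Unique L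
        closed   : ∀ {z} → z ∈ L → σ z ∈ L
        periodic : ∀ {z} → z ∈ L → Periodic z

      σ^-closed : ∀ {z} → z ∈ L → ∀ i → σ^ i z ∈ L
      σ^-closed z∈ zero = z∈
      σ^-closed z∈ (suc i) = closed (σ^-closed z∈ i)

    filter-∁-Invariant : ∀ {ℓ} {R : Pred A ℓ} (R? : Decidable R) {L} → Invariant L →
      (∀ {z} → z ∈ L → R (σ z) → R z) → Invariant (filter (∁? R?) L)
    filter-∁-Invariant R? inv R-σ⁻ = record
      { unique   = filter⁺ (∁? R?) unique
      ; closed   = λ z∈ → let z∈L , ¬Rz = ∈-filter⁻ (∁? R?) z∈ in
                          ∈-filter⁺ (∁? R?) (closed z∈L) (¬Rz ∘ R-σ⁻ z∈L)
      ; periodic = periodic ∘ proj₁ ∘ ∈-filter⁻ (∁? R?)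
      }
      where open Invariant inv

    -- Removing the orbit of the first point, which has n elements, leaves an invariant list.
    n∣length-free : ∀ {L} → Acc _<_ (length L) → Invariant L → (∀ {z} → z ∈ L → ¬ Fixed z) → n ∣ length L
    n∣length-free {[]} _ _ _ = n ∣0
    n∣length-free {L@(e ∷ _)} (acc rs) inv free = subst (n ∣_) split (∣m∣n⇒∣m+n n∣n rec)
      where
      open Invariant inv
      O = orbit e
      en = periodic (here refl)
      rest = filter (∁? (_∈? O)) L
      O⊆L : ∀ {z} → z ∈ O → z ∈ L × z ∈ O
      O⊆L z∈O = let i , z≡ = ∈-tabulate⁻ z∈O in subst (_∈ L) (sym z≡) (σ^-closed (here refl) (toℕ i)) , z∈O
      length-O∩L : length (filter (_∈? O) L) ≡ n
      length-O∩L = trans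
        (length-filter≡length (_∈? O) unique (orbit-unique en (free (here refl))) O⊆L (λ _ z∈O → z∈O))
                         (length-tabulate _)
      split : n + length rest ≡ length L
      split = trans (cong (_+ length rest) (sym length-O∩L)) (length-filter+length-filter-∁ (_∈? O) L)
      rec : n ∣ length rest
      rec = n∣length-free (rs (subst (length rest <_) split (m<n+m _ (>-nonZero⁻¹ n))))
              (filter-∁-Invariant (_∈? O) inv (λ z∈ → ∈-orbit-σ⁻ en (periodic z∈)))
              (free ∘ proj₁ ∘ ∈-filter⁻ (∁? (_∈? O)))

    length≡fixed+multiple : ∀ {L} → Invariant L → ∃[ k ] length L ≡ length (filter fixed? L) + k * n
    length≡fixed+multiple {L} inv
      with n∣length-free (<-wellFounded _) (filter-∁-Invariant fixed? inv (Fixed-σ⁻ ∘ Invariant.periodic inv))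
                         (proj₂ ∘ ∈-filter⁻ (∁? fixed?) {xs = L})
    ... | divides k eq =
      k , trans (sym (length-filter+length-filter-∁ fixed? L)) (cong (length (filter fixed? L) +_) eq)

-- Arithmetic modulo p

module Modular (p : ℕ) .{{_ : NonZero p}} where

  ≈-setoid : Setoid 0ℓ 0ℓ
  ≈-setoid = On.setoid (≡.setoid ℕ) (_% p)

  open Setoid ≈-setoid public
    using (_≈_; _≉_) renaming (refl to ≈-refl; sym to ≈-sym; trans to ≈-trans; reflexive to ≡⇒≈)
  open SetoidReasoning ≈-setoid public

  +-cong : ∀ {a a′ b b′} → a ≈ a′ → b ≈ b′ → a + b ≈ a′ + b′
  +-cong {a} {a′} {b} {b′} a≈a′ b≈b′ =
    trans (%-distribˡ-+ a b p) (trans (cong₂ (λ x y → (x + y) % p) a≈a′ b≈b′) (sym (%-distribˡ-+ a′ b′ p)))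

  +-congˡ : ∀ a {b b′} → b ≈ b′ → a + b ≈ a + b′
  +-congˡ a = +-cong {a} ≈-refl

  +-congʳ : ∀ {a a′} b → a ≈ a′ → a + b ≈ a′ + b
  +-congʳ b a≈a′ = +-cong a≈a′ (≈-refl {b})

  *-cong : ∀ {a a′ b b′} → a ≈ a′ → b ≈ b′ → a * b ≈ a′ * b′
  *-cong {a} {a′} {b} {b′} a≈a′ b≈b′ =
    trans (%-distribˡ-* a b p) (trans (cong₂ (λ x y → (x * y) % p) a≈a′ b≈b′) (sym (%-distribˡ-* a′ b′ p)))

  *-congˡ : ∀ a {b b′} → b ≈ b′ → a * b ≈ a * b′
  *-congˡ a = *-cong {a} ≈-refl

  *-congʳ : ∀ {a a′} b → a ≈ a′ → a * b ≈ a′ * b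
  *-congʳ b a≈a′ = *-cong a≈a′ (≈-refl {b})

  %-≈ : ∀ a → a % p ≈ a
  %-≈ a = m%n%n≡m%n a p

  *p≈0 : ∀ k → k * p ≈ 0
  *p≈0 k = [m+kn]%n≡m%n 0 k p

  residue-≡ : ∀ {a b} → a < p → b < p → a ≈ b → a ≡ b
  residue-≡ a<p b<p a≈b = trans (sym (m<n⇒m%n≡m a<p)) (trans a≈b (m<n⇒m%n≡m b<p))

  −1 : ℕ
  −1 = pred p

  1+−1≈0 : 1 + −1 ≈ 0
  1+−1≈0 = begin
    1 + −1  ≡⟨ suc-pred p ⟩
    p       ≡⟨ *-identityˡ p ⟨
    1 * p   ≈⟨ *p≈0 1 ⟩
    0       ∎

  x+−1*x≈0 : ∀ x → x + −1 * x ≈ 0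
  x+−1*x≈0 x = begin
    x + −1 * x    ≡⟨ distrib x −1 ⟩
    (1 + −1) * x  ≈⟨ *-congʳ x 1+−1≈0 ⟩
    0             ∎
    where
    distrib : ∀ x u → x + u * x ≡ (1 + u) * x
    distrib = solve-∀

  +≈0⇒≈−1* : ∀ {u v} → u + v ≈ 0 → u ≈ −1 * v
  +≈0⇒≈−1* {u} {v} u+v≈0 = begin
    u                 ≡⟨ +-identityʳ u ⟨
    u + 0             ≈⟨ +-congˡ u (x+−1*x≈0 v) ⟨
    u + (v + −1 * v)  ≡⟨ +-assoc u v _ ⟨
    u + v + −1 * v    ≈⟨ +-congʳ (−1 * v) u+v≈0 ⟩
    −1 * v            ∎

  −1*−1≈1 : −1 * −1 ≈ 1
  −1*−1≈1 = ≈-sym (+≈0⇒≈−1* 1+−1≈0)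

  ≈−1*⇒+≈0 : ∀ {u v} → u ≈ −1 * v → u + v ≈ 0
  ≈−1*⇒+≈0 {u} {v} u≈−v = begin
    u + v       ≈⟨ +-congʳ v u≈−v ⟩
    −1 * v + v  ≡⟨ +-comm (−1 * v) v ⟩
    v + −1 * v  ≈⟨ x+−1*x≈0 v ⟩
    0           ∎

  −1*−1*−1≈−1 : −1 * −1 * −1 ≈ −1
  −1*−1*−1≈−1 = ≈-trans (*-congʳ −1 −1*−1≈1) (≡⇒≈ (*-identityˡ −1))

  −1*[−1*x]≈x : ∀ x → −1 * (−1 * x) ≈ x
  −1*[−1*x]≈x x = begin
    −1 * (−1 * x)  ≡⟨ *-assoc −1 −1 x ⟨
    −1 * −1 * x    ≈⟨ *-congʳ x −1*−1≈1 ⟩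
    1 * x          ≡⟨ *-identityˡ x ⟩
    x              ∎

module PrimeField {p : ℕ} (p-prime : Prime p) where

  private instance
    p≢0 : NonZero p
    p≢0 = prime⇒nonZero p-prime

  open Modular p {{p≢0}} public

  0%p≡0 : 0 % p ≡ 0
  0%p≡0 = n∣m⇒m%n≡0 0 p (p ∣0)

  ≈0⇒∣ : ∀ {a} → a ≈ 0 → p ∣ a
  ≈0⇒∣ {a} a≈0 = m%n≡0⇒n∣m a p (trans a≈0 0%p≡0)

  ∣⇒≈0 : ∀ {a} → p ∣ a → a ≈ 0
  ∣⇒≈0 {a} p∣a = trans (n∣m⇒m%n≡0 a p p∣a) (sym 0%p≡0)

  *≈0⇒ : ∀ a b → a * b ≈ 0 → a ≈ 0 ⊎ b ≈ 0
  *≈0⇒ a b ab≈0 with euclidsLemma a b p-prime (≈0⇒∣ ab≈0)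
  ... | inj₁ p∣a = inj₁ (∣⇒≈0 p∣a)
  ... | inj₂ p∣b = inj₂ (∣⇒≈0 p∣b)

  *-≉0 : ∀ {a b} → a ≉ 0 → b ≉ 0 → a * b ≉ 0
  *-≉0 {a} {b} a≉0 b≉0 ab≈0 with *≈0⇒ a b ab≈0
  ... | inj₁ a≈0 = a≉0 a≈0
  ... | inj₂ b≈0 = b≉0 b≈0

  residue-≉0 : ∀ {a} → 0 < a → a < p → a ≉ 0
  residue-≉0 0<a a<p a≈0 with residue-≡ a<p (>-nonZero⁻¹ p) a≈0
  residue-≉0 () a<p a≈0 | refl

  1<p : 1 < p
  1<p = nonTrivial⇒n>1 p {{prime⇒nonTrivial p-prime}}

  1≉0 : 1 ≉ 0
  1≉0 = residue-≉0 (s≤s z≤n) 1<p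

  ≈−1*-self⇒≈0 : 2 ≉ 0 → ∀ {x} → x ≈ −1 * x → x ≈ 0
  ≈−1*-self⇒≈0 2≉0 {x} x≈−x = [ ⊥-elim ∘ 2≉0 , (λ x≈0 → x≈0) ]′ (*≈0⇒ 2 x 2x≈0)
    where
    2x≈0 : 2 * x ≈ 0
    2x≈0 = begin
      2 * x       ≡⟨ cong (x +_) (+-identityʳ x) ⟩
      x + x       ≈⟨ +-congˡ x x≈−x ⟩
      x + −1 * x  ≈⟨ x+−1*x≈0 x ⟩
      0           ∎

  square-roots : ∀ {y s} → y * y ≈ s * s → y ≈ s ⊎ y ≈ −1 * s
  square-roots {y} {s} yy≈ss =
    [ (λ y−s≈0 → inj₁ (≈-trans (+≈0⇒≈−1* y−s≈0) (−1*[−1*x]≈x s))) , inj₂ ∘ +≈0⇒≈−1* ]′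
    (*≈0⇒ (y + −1 * s) (y + s) product≈0)
    where
    expand : ∀ y s u → (y + u * s) * (y + s) ≡ (y * y + u * (s * s)) + (1 + u) * s * y
    expand = solve-∀
    product≈0 : (y + −1 * s) * (y + s) ≈ 0
    product≈0 = begin
      (y + −1 * s) * (y + s)                     ≡⟨ expand y s −1 ⟩
      (y * y + −1 * (s * s)) + (1 + −1) * s * y
        ≈⟨ +-cong (+-congʳ (−1 * (s * s)) yy≈ss) (*-congʳ y (*-congʳ s 1+−1≈0)) ⟩
      (s * s + −1 * (s * s)) + 0                 ≈⟨ +-congʳ 0 (x+−1*x≈0 (s * s)) ⟩
      0                                          ∎

  record CubeRootOfUnity : Set where
    field
      ω    : ℕ
      ω<p  : ω < p
      ω≢1  : ω ≢ 1
      ω³≈1 : ω * ω * ω ≈ 1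

  gcd[a,p]≡1 : ∀ {a d} → a ≉ 0 → GCD a p d → d ≡ 1
  gcd[a,p]≡1 a≉0 g with prime⇒irreducible p-prime (GCD.gcd∣n g)
  ... | inj₁ d≡1 = d≡1
  ... | inj₂ refl = ⊥-elim (a≉0 (∣⇒≈0 (GCD.gcd∣m g)))

  inverse : ℕ → ℕ
  inverse a with Bézout.lemma a p
  ... | Bézout.result _ _ (Bézout.+- x _ _) = x % p
  ... | Bézout.result _ _ (Bézout.-+ x _ _) = (−1 * x) % p

  inverse<p : ∀ a → inverse a < p
  inverse<p a with Bézout.lemma a p
  ... | Bézout.result _ _ (Bézout.+- x _ _) = m%n<n x p
  ... | Bézout.result _ _ (Bézout.-+ x _ _) = m%n<n (−1 * x) p

  *-inverse : ∀ {a} → a ≉ 0 → a * inverse a ≈ 1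
  *-inverse {a} a≉0 with Bézout.lemma a p
  ... | Bézout.result d g (Bézout.+- x y eq) = begin
    a * (x % p)  ≈⟨ *-congˡ a (%-≈ x) ⟩
    a * x        ≡⟨ *-comm a x ⟩
    x * a        ≡⟨ eq ⟨
    d + y * p    ≈⟨ +-congˡ d (*p≈0 y) ⟩
    d + 0        ≡⟨ +-identityʳ d ⟩
    d            ≡⟨ gcd[a,p]≡1 a≉0 g ⟩
    1            ∎
  ... | Bézout.result d g (Bézout.-+ x y eq) = begin
    a * ((−1 * x) % p)  ≈⟨ *-congˡ a (%-≈ (−1 * x)) ⟩
    a * (−1 * x)        ≡⟨ rearrange a x −1 ⟩
    −1 * (x * a)        ≈⟨ +≈0⇒≈−1* (≈-trans (≡⇒≈ eq) (*p≈0 y)) ⟨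
    d                   ≡⟨ gcd[a,p]≡1 a≉0 g ⟩
    1                   ∎
    where
    rearrange : ∀ a x u → a * (u * x) ≡ u * (x * a)
    rearrange = solve-∀

  inverse-≉0 : ∀ {a} → a ≉ 0 → inverse a ≉ 0
  inverse-≉0 {a} a≉0 i≈0 = 1≉0 (begin
    1              ≈⟨ *-inverse a≉0 ⟨
    a * inverse a  ≈⟨ *-congˡ a i≈0 ⟩
    a * 0          ≡⟨ *-zeroʳ a ⟩
    0              ∎)

  inverse-unique : ∀ a {c} → a * c ≈ 1 → c < p → inverse a ≡ c
  inverse-unique a {c} ac≈1 c<p = residue-≡ (inverse<p a) c<p (begin
    inverse a              ≡⟨ *-identityʳ (inverse a) ⟨
    inverse a * 1          ≈⟨ *-congˡ (inverse a) ac≈1 ⟨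
    inverse a * (a * c)    ≡⟨ rearrange (inverse a) a c ⟩
    (a * inverse a) * c    ≈⟨ *-congʳ c (*-inverse a≉0) ⟩
    1 * c                  ≡⟨ *-identityˡ c ⟩
    c                      ∎)
    where
    a≉0 : a ≉ 0
    a≉0 a≈0 = 1≉0 (≈-trans (≈-sym ac≈1) (*-congʳ c a≈0))
    rearrange : ∀ i a c → i * (a * c) ≡ (a * i) * c
    rearrange = solve-∀

-- Cube roots of unity

module _ {p : ℕ} (p-prime : Prime p) where

  open PrimeField p-prime

  private instance
    p≢0 : NonZero p
    p≢0 = prime⇒nonZero p-prime

  units : List ℕ
  units = map suc (upTo (pred p))

  ∈-units⁺ : ∀ {x} → x ≉ 0 → x < p → x ∈ units
  ∈-units⁺ {zero} 0≉0 _ = ⊥-elim (0≉0 ≈-refl)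
  ∈-units⁺ {suc x} _ x<p = ∈-map⁺ suc (∈-upTo⁺ (≤-pred (subst (suc x <_) (sym (suc-pred p)) x<p)))

  ∈-units⁻ : ∀ {x} → x ∈ units → x ≉ 0 × x < p
  ∈-units⁻ x∈ with ∈-map⁻ suc x∈
  ... | i , i∈ , refl = residue-≉0 (s≤s z≤n) 1+i<p , 1+i<p
    where
    1+i<p = subst (suc i <_) (suc-pred p) (s≤s (∈-upTo⁻ i∈))

  -- (x , y) ↦ (y , (x y)⁻¹) cyclically permutes the three factors of x · y · (x y)⁻¹ = 1.
  ρ : ℕ × ℕ → ℕ × ℕ
  ρ (x , y) = y , inverse (x * y)

  module ρ = PrimePeriod _≟²_ ρ

  unitPairs : List (ℕ × ℕ)
  unitPairs = cartesianProduct units units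

  unitPairs-Invariant : ρ.Invariant prime[3] unitPairs
  unitPairs-Invariant = record
    { unique   = cartesianProduct⁺ units-unique units-unique
    ; closed   = closed
    ; periodic = periodic
    }
    where
    units-unique : Unique units
    units-unique = map⁺ suc-injective (upTo⁺ (pred p))
    inverse-∈ : ∀ {x y} → x ∈ units → y ∈ units → inverse (x * y) ∈ units
    inverse-∈ {x} {y} x∈ y∈ =
      ∈-units⁺ {inverse (x * y)} (inverse-≉0 (*-≉0 (proj₁ (∈-units⁻ x∈)) (proj₁ (∈-units⁻ y∈)))) (inverse<p (x * y))
    closed : ∀ {z} → z ∈ unitPairs → ρ z ∈ unitPairs
    closed {x , y} z∈ = let x∈ , y∈ = ∈-cartesianProduct⁻ units units z∈ in ∈-cartesianProduct⁺ y∈ (inverse-∈ x∈ y∈)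
    periodic : ∀ {z} → z ∈ unitPairs → ρ (ρ (ρ z)) ≡ z
    periodic {x , y} z∈ = cong₂ _,_ inverse[yi]≡x (trans (cong (λ t → inverse (i * t)) inverse[yi]≡x) inverse[ix]≡y)
      where
      x∈ = proj₁ (∈-cartesianProduct⁻ units units z∈)
      y∈ = proj₂ (∈-cartesianProduct⁻ units units z∈)
      i = inverse (x * y)
      xyi≈1 : x * y * i ≈ 1
      xyi≈1 = *-inverse (*-≉0 (proj₁ (∈-units⁻ x∈)) (proj₁ (∈-units⁻ y∈)))
      rotate₁ : ∀ x y i → y * i * x ≡ x * y * i
      rotate₁ = solve-∀
      rotate₂ : ∀ x y i → i * x * y ≡ x * y * i
      rotate₂ = solve-∀
      inverse[yi]≡x : inverse (y * i) ≡ x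
      inverse[yi]≡x = inverse-unique (y * i) (≈-trans (≡⇒≈ (rotate₁ x y i)) xyi≈1) (proj₂ (∈-units⁻ x∈))
      inverse[ix]≡y : inverse (i * x) ≡ y
      inverse[ix]≡y = inverse-unique (i * x) (≈-trans (≡⇒≈ (rotate₂ x y i)) xyi≈1) (proj₂ (∈-units⁻ y∈))

  fixedPairs : List (ℕ × ℕ)
  fixedPairs = filter ρ.fixed? unitPairs

  ∈-fixedPairs⁻ : ∀ {x y} → (x , y) ∈ fixedPairs → y ≡ x × x < p × x * x * x ≈ 1
  ∈-fixedPairs⁻ {x} {y} z∈ with ∈-filter⁻ ρ.fixed? z∈
  ... | z∈U , ρz≡z with cong proj₁ ρz≡z
  ... | refl = refl , x<p , ≈-trans (≡⇒≈ (cong (x * x *_) (sym (cong proj₂ ρz≡z)))) (*-inverse (*-≉0 x≉0 x≉0))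
    where
    x≉0 = proj₁ (∈-units⁻ (proj₁ (∈-cartesianProduct⁻ units units z∈U)))
    x<p = proj₂ (∈-units⁻ (proj₁ (∈-cartesianProduct⁻ units units z∈U)))

  3∣length-fixedPairs : p % 3 ≡ 1 → 3 ∣ length fixedPairs
  3∣length-fixedPairs p%3≡1 =
    ∣m+n∣m⇒∣n (subst (3 ∣_) (trans length≡ (+-comm (length fixedPairs) (k * 3))) (∣-trans (n∣m*n q) (m∣m*n (q * 3))))
              (n∣m*n k)
    where
    q = p / 3
    p-1≡q*3 : pred p ≡ q * 3
    p-1≡q*3 = trans (cong pred (m≡m%n+[m/n]*n p 3)) (cong (λ r → pred (r + q * 3)) p%3≡1)
    length-units : length units ≡ q * 3
    length-units = trans (length-map suc (upTo (pred p))) (trans (length-upTo (pred p)) p-1≡q*3)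
    count = ρ.length≡fixed+multiple prime[3] unitPairs-Invariant
    k = proj₁ count
    length≡ : q * 3 * (q * 3) ≡ length fixedPairs + k * 3
    length≡ = trans (sym (trans (length-cartesianProduct units units) (cong₂ _*_ length-units length-units)))
                    (proj₂ count)

  -- (1 , 1) is a fixed pair, and 3 divides their number, so there is another one.
  cube-root-of-unity : p % 3 ≡ 1 → CubeRootOfUnity
  cube-root-of-unity p%3≡1 = fromOther (∈-nonempty others≢0)
    where
    others = filter (∁? (_≟² (1 , 1))) fixedPairs
    1∈units : 1 ∈ units
    1∈units = ∈-units⁺ 1≉0 1<p
    length-ones : length (filter (_≟² (1 , 1)) fixedPairs) ≡ 1
    length-ones = length-filter≡length (_≟² (1 , 1))
      (filter⁺ ρ.fixed? (ρ.Invariant.unique unitPairs-Invariant)) ([] ∷ [])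
      (λ { (here refl) → ∈-filter⁺ ρ.fixed? (∈-cartesianProduct⁺ 1∈units 1∈units)
                                   (cong (1 ,_) (inverse-unique 1 refl 1<p))
                       , refl })
      (λ _ z≡11 → here z≡11)
    others≢0 : length others ≢ 0
    others≢0 others≡0 = 3≢1 (∣1⇒≡1 (subst (3 ∣_) length≡1 (3∣length-fixedPairs p%3≡1)))
      where
      3≢1 : 3 ≢ 1
      3≢1 ()
      length≡1 : length fixedPairs ≡ 1
      length≡1 = trans (sym (length-filter+length-filter-∁ (_≟² (1 , 1)) fixedPairs)) (cong₂ _+_ length-ones others≡0)
    fromOther : ∃[ z ] z ∈ others → CubeRootOfUnity
    fromOther ((x , y) , z∈) with ∈-filter⁻ (∁? (_≟² (1 , 1))) {xs = fixedPairs} z∈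
    ... | z∈F , z≢11 with ∈-fixedPairs⁻ z∈F
    ... | refl , x<p , x³≈1 = record { ω = x ; ω<p = x<p ; ω≢1 = λ x≡1 → z≢11 (cong₂ _,_ x≡1 x≡1) ; ω³≈1 = x³≈1 }

-- The curve y² = x³ + c

module Curve {p : ℕ} (p-prime : Prime p) (c : ℕ) where

  open PrimeField p-prime

  private instance
    p≢0 : NonZero p
    p≢0 = prime⇒nonZero p-prime

  points : List (ℕ × ℕ)
  points = affinePoints p c

  ∈-points⁺ : ∀ {x y} → x < p → y < p → y * y ≈ x * x * x + c → (x , y) ∈ points
  ∈-points⁺ x<p y<p on-curve = ∈-filter⁺ _ (∈-cartesianProduct⁺ (∈-upTo⁺ x<p) (∈-upTo⁺ y<p)) on-curve

  ∈-points⁻ : ∀ {x y} → (x , y) ∈ points → x < p × y < p × y * y ≈ x * x * x + c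
  ∈-points⁻ z∈ with ∈-filter⁻ _ {xs = cartesianProduct (upTo p) (upTo p)} z∈
  ... | z∈grid , on-curve with ∈-cartesianProduct⁻ (upTo p) (upTo p) z∈grid
  ...   | x∈ , y∈ = ∈-upTo⁻ x∈ , ∈-upTo⁻ y∈ , on-curve

  points-unique : Unique points
  points-unique = filter⁺ _ (cartesianProduct⁺ (upTo⁺ p) (upTo⁺ p))

  negate : ℕ × ℕ → ℕ × ℕ
  negate (x , y) = x , (−1 * y) % p

  module negate = PrimePeriod _≟²_ negate

  negate-Invariant : negate.Invariant prime[2] points
  negate-Invariant = record { unique = points-unique ; closed = closed ; periodic = periodic }
    where
    closed : ∀ {z} → z ∈ points → negate z ∈ points
    closed {x , y} z∈ with ∈-points⁻ z∈
    ... | x<p , y<p , on-curve = ∈-points⁺ x<p (m%n<n (−1 * y) p) (begin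
      (−1 * y) % p * ((−1 * y) % p)  ≈⟨ *-cong (%-≈ (−1 * y)) (%-≈ (−1 * y)) ⟩
      (−1 * y) * (−1 * y)            ≡⟨ rearrange −1 y ⟩
      (−1 * −1) * (y * y)            ≈⟨ *-cong −1*−1≈1 on-curve ⟩
      1 * (x * x * x + c)            ≡⟨ *-identityˡ _ ⟩
      x * x * x + c                  ∎)
      where
      rearrange : ∀ u y → (u * y) * (u * y) ≡ (u * u) * (y * y)
      rearrange = solve-∀
    periodic : ∀ {z} → z ∈ points → negate (negate z) ≡ z
    periodic {x , y} z∈ = cong (x ,_) (residue-≡ (m%n<n _ p) (proj₁ (proj₂ (∈-points⁻ z∈))) (begin
      (−1 * ((−1 * y) % p)) % p  ≈⟨ %-≈ _ ⟩
      −1 * ((−1 * y) % p)        ≈⟨ *-congˡ −1 (%-≈ (−1 * y)) ⟩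
      −1 * (−1 * y)              ≈⟨ −1*[−1*x]≈x y ⟩
      y                          ∎))

  roots : List (ℕ × ℕ)
  roots = filter negate.fixed? points

  ∈-roots⁺ : ∀ {x} → x < p → x * x * x + c ≈ 0 → (x , 0) ∈ roots
  ∈-roots⁺ {x} x<p root = ∈-filter⁺ negate.fixed? (∈-points⁺ x<p (>-nonZero⁻¹ p) (≈-sym root)) (cong (x ,_) −0≡0)
    where
    −0≡0 : (−1 * 0) % p ≡ 0
    −0≡0 = trans (cong (_% p) (*-zeroʳ −1)) 0%p≡0

  ∈-roots⁻ : 2 ≉ 0 → ∀ {x y} → (x , y) ∈ roots → y ≡ 0 × x < p × x * x * x + c ≈ 0
  ∈-roots⁻ 2≉0 {x} {y} z∈ with ∈-filter⁻ negate.fixed? z∈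
  ... | z∈points , fixed with ∈-points⁻ z∈points
  ...   | x<p , y<p , on-curve with residue-≡ y<p (>-nonZero⁻¹ p) y≈0
    where
    y≈0 : y ≈ 0
    y≈0 = ≈−1*-self⇒≈0 2≉0 (≈-trans (≡⇒≈ (sym (cong proj₂ fixed))) (%-≈ (−1 * y)))
  ... | refl = refl , x<p , ≈-sym on-curve

  module Rotation (ζ : CubeRootOfUnity) where

    open CubeRootOfUnity ζ

    rotate : ℕ × ℕ → ℕ × ℕ
    rotate (x , y) = (ω * x) % p , y

    module rotate = PrimePeriod _≟²_ rotate

    rotate-Invariant : rotate.Invariant prime[3] points
    rotate-Invariant = record { unique = points-unique ; closed = closed ; periodic = periodic }
      where
      closed : ∀ {z} → z ∈ points → rotate z ∈ points
      closed {x , y} z∈ with ∈-points⁻ z∈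
      ... | x<p , y<p , on-curve = ∈-points⁺ (m%n<n (ω * x) p) y<p (begin
        y * y                                           ≈⟨ on-curve ⟩
        x * x * x + c                                   ≡⟨ cong (_+ c) (*-identityˡ (x * x * x)) ⟨
        1 * (x * x * x) + c                             ≈⟨ +-congʳ c (*-congʳ (x * x * x) ω³≈1) ⟨
        (ω * ω * ω) * (x * x * x) + c                   ≡⟨ cong (_+ c) (rearrange ω x) ⟩
        (ω * x) * (ω * x) * (ω * x) + c                 ≈⟨ +-congʳ c (*-cong (*-cong ωx≈ ωx≈) ωx≈) ⟨
        (ω * x) % p * ((ω * x) % p) * ((ω * x) % p) + c ∎)
        where
        ωx≈ = %-≈ (ω * x)
        rearrange : ∀ ω x → (ω * ω * ω) * (x * x * x) ≡ (ω * x) * (ω * x) * (ω * x)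
        rearrange = solve-∀
      periodic : ∀ {z} → z ∈ points → rotate (rotate (rotate z)) ≡ z
      periodic {x , y} z∈ = cong (_, y) (residue-≡ (m%n<n _ p) (proj₁ (∈-points⁻ z∈)) (begin
        (ω * ((ω * ((ω * x) % p)) % p)) % p  ≈⟨ %-≈ _ ⟩
        ω * ((ω * ((ω * x) % p)) % p)        ≈⟨ *-congˡ ω (%-≈ _) ⟩
        ω * (ω * ((ω * x) % p))              ≈⟨ *-congˡ ω (*-congˡ ω (%-≈ (ω * x))) ⟩
        ω * (ω * (ω * x))                    ≡⟨ rearrange ω x ⟩
        (ω * ω * ω) * x                      ≈⟨ *-congʳ x ω³≈1 ⟩
        1 * x                                ≡⟨ *-identityˡ x ⟩
        x                                    ∎))
        where
        rearrange : ∀ ω x → ω * (ω * (ω * x)) ≡ (ω * ω * ω) * x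
        rearrange = solve-∀

    axisPoints : List (ℕ × ℕ)
    axisPoints = filter rotate.fixed? points

    ∈-axisPoints⁺ : ∀ {y} → y < p → y * y ≈ c → (0 , y) ∈ axisPoints
    ∈-axisPoints⁺ {y} y<p yy≈c = ∈-filter⁺ rotate.fixed? (∈-points⁺ (>-nonZero⁻¹ p) y<p yy≈c) (cong (_, y) ω0≡0)
      where
      ω0≡0 : (ω * 0) % p ≡ 0
      ω0≡0 = trans (cong (_% p) (*-zeroʳ ω)) 0%p≡0

    ∈-axisPoints⁻ : ∀ {x y} → (x , y) ∈ axisPoints → x ≡ 0 × y < p × y * y ≈ c
    ∈-axisPoints⁻ {x} {y} z∈ with ∈-filter⁻ rotate.fixed? z∈
    ... | z∈points , fixed with ∈-points⁻ z∈points
    ...   | x<p , y<p , on-curve with *≈0⇒ (ω + −1) x ω−1*x≈0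
      where
      ω−1*x≈0 : (ω + −1) * x ≈ 0
      ω−1*x≈0 = begin
        (ω + −1) * x    ≡⟨ *-distribʳ-+ x ω −1 ⟩
        ω * x + −1 * x  ≈⟨ +-congʳ (−1 * x) (≈-trans (≈-sym (%-≈ (ω * x))) (≡⇒≈ (cong proj₁ fixed))) ⟩
        x + −1 * x      ≈⟨ x+−1*x≈0 x ⟩
        0               ∎
    ... | inj₁ ω−1≈0 = ⊥-elim (ω≢1 (residue-≡ ω<p 1<p (≈-trans (+≈0⇒≈−1* ω−1≈0) −1*−1≈1)))
    ... | inj₂ x≈0 with residue-≡ x<p (>-nonZero⁻¹ p) x≈0
    ...   | refl = refl , y<p , on-curve

-- The curve y² = x³ + a³

module _ {p : ℕ} (p-prime : Prime p) {a : ℕ} (a≉0 : PrimeField._≉_ p-prime a 0) where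

  open PrimeField p-prime
  open Curve p-prime (a * a * a)

  private instance
    p≢0 : NonZero p
    p≢0 = prime⇒nonZero p-prime

  private
    c = a * a * a

    a*a⁻¹≈1 : a * inverse a ≈ 1
    a*a⁻¹≈1 = *-inverse a≉0

    [a*a⁻¹]³≈1 : (a * inverse a) * (a * inverse a) * (a * inverse a) ≈ 1
    [a*a⁻¹]³≈1 = *-cong (*-cong a*a⁻¹≈1 a*a⁻¹≈1) a*a⁻¹≈1

  τ₀ : ℕ → ℕ
  τ₀ x = (−1 * (x * x * inverse a)) % p

  module _ {x : ℕ} (root : x * x * x + c ≈ 0) where

    private
      x³≈−c : x * x * x ≈ −1 * c
      x³≈−c = +≈0⇒≈−1* root

    τ₀-root : τ₀ x * τ₀ x * τ₀ x + c ≈ 0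
    τ₀-root = ≈−1*⇒+≈0 {τ₀ x * τ₀ x * τ₀ x} {c} (begin
      τ₀ x * τ₀ x * τ₀ x                                         ≈⟨ *-cong (*-cong t≈ t≈) t≈ ⟩
      t * t * t                                                  ≡⟨ expand −1 x (inverse a) ⟩
      (−1 * −1 * −1) * ((x * x * x) * (x * x * x)) * (i * i * i)
        ≈⟨ *-congʳ (i * i * i) (*-cong −1*−1*−1≈−1 (*-cong x³≈−c x³≈−c)) ⟩
      −1 * ((−1 * c) * (−1 * c)) * (i * i * i)                   ≡⟨ collect −1 a i ⟩
      (−1 * −1) * (−1 * ((a * i) * (a * i) * (a * i) * c))
        ≈⟨ *-cong −1*−1≈1 (*-congˡ −1 (*-congʳ c [a*a⁻¹]³≈1)) ⟩
      1 * (−1 * (1 * c))                                         ≡⟨ cong (λ v → 1 * (−1 * v)) (*-identityˡ c) ⟩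
      1 * (−1 * c)                                               ≡⟨ *-identityˡ (−1 * c) ⟩
      −1 * c                                                     ∎)
      where
      i = inverse a
      t = −1 * (x * x * i)
      t≈ = %-≈ t
      expand : ∀ u x i → (u * (x * x * i)) * (u * (x * x * i)) * (u * (x * x * i))
                         ≡ (u * u * u) * ((x * x * x) * (x * x * x)) * (i * i * i)
      expand = solve-∀
      collect : ∀ u a i → u * ((u * (a * a * a)) * (u * (a * a * a))) * (i * i * i)
                          ≡ (u * u) * (u * ((a * i) * (a * i) * (a * i) * (a * a * a)))
      collect = solve-∀

    τ₀-involutive : x < p → τ₀ (τ₀ x) ≡ x
    τ₀-involutive x<p = residue-≡ (m%n<n _ p) x<p (begin
      τ₀ (τ₀ x)                                      ≈⟨ %-≈ _ ⟩
      −1 * (τ₀ x * τ₀ x * i)                         ≈⟨ *-congˡ −1 (*-congʳ i (*-cong t≈ t≈)) ⟩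
      −1 * (t * t * i)                               ≡⟨ expand −1 x i ⟩
      (−1 * −1 * −1) * (x * x * x) * x * (i * i * i)
        ≈⟨ *-congʳ (i * i * i) (*-congʳ x (*-cong −1*−1*−1≈−1 x³≈−c)) ⟩
      −1 * (−1 * c) * x * (i * i * i)                ≡⟨ collect −1 a i x ⟩
      (−1 * −1) * ((a * i) * (a * i) * (a * i)) * x  ≈⟨ *-congʳ x (*-cong −1*−1≈1 [a*a⁻¹]³≈1) ⟩
      1 * 1 * x                                      ≡⟨ *-identityˡ x ⟩
      x                                              ∎)
      where
      i = inverse a
      t = −1 * (x * x * i)
      t≈ = %-≈ t
      expand : ∀ u x i → u * ((u * (x * x * i)) * (u * (x * x * i)) * i)
                         ≡ (u * u * u) * (x * x * x) * x * (i * i * i)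
      expand = solve-∀
      collect : ∀ u a i x → u * (u * (a * a * a)) * x * (i * i * i) ≡ (u * u) * ((a * i) * (a * i) * (a * i)) * x
      collect = solve-∀

    τ₀-fixed⇒≡−a : x < p → τ₀ x ≡ x → x ≡ (−1 * a) % p
    τ₀-fixed⇒≡−a x<p τ₀x≡x = [ from-x≈0 , from-x+a≈0 ]′ (*≈0⇒ x (x + a) x[x+a]≈0)
      where
      τ₀x≈x : −1 * (x * x * inverse a) ≈ x
      τ₀x≈x = ≈-trans (≈-sym (%-≈ (−1 * (x * x * inverse a)))) (≡⇒≈ τ₀x≡x)
      ax≈−x² : a * x ≈ −1 * (x * x)
      ax≈−x² = begin
        a * x                           ≈⟨ *-congˡ a τ₀x≈x ⟨
        a * (−1 * (x * x * inverse a))  ≡⟨ rearrange a x −1 (inverse a) ⟩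
        −1 * (x * x) * (a * inverse a)  ≈⟨ *-congˡ (−1 * (x * x)) a*a⁻¹≈1 ⟩
        −1 * (x * x) * 1                ≡⟨ *-identityʳ (−1 * (x * x)) ⟩
        −1 * (x * x)                    ∎
        where
        rearrange : ∀ a x u i → a * (u * (x * x * i)) ≡ u * (x * x) * (a * i)
        rearrange = solve-∀
      x[x+a]≈0 : x * (x + a) ≈ 0
      x[x+a]≈0 = ≈-trans (≡⇒≈ (expand x a)) (≈−1*⇒+≈0 ax≈−x²)
        where
        expand : ∀ x a → x * (x + a) ≡ a * x + x * x
        expand = solve-∀
      from-x≈0 : x ≈ 0 → x ≡ (−1 * a) % p
      from-x≈0 x≈0 = ⊥-elim (*-≉0 (*-≉0 a≉0 a≉0) a≉0 (begin
        0 * 0 * 0 + c  ≈⟨ +-congʳ c (*-cong (*-cong x≈0 x≈0) x≈0) ⟨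
        x * x * x + c  ≈⟨ root ⟩
        0              ∎))
      from-x+a≈0 : x + a ≈ 0 → x ≡ (−1 * a) % p
      from-x+a≈0 x+a≈0 = residue-≡ x<p (m%n<n (−1 * a) p) (≈-trans (+≈0⇒≈−1* x+a≈0) (≈-sym (%-≈ (−1 * a))))

  −a : ℕ
  −a = (−1 * a) % p

  −a-root : −a * −a * −a + c ≈ 0
  −a-root = ≈−1*⇒+≈0 {−a * −a * −a} {c} (begin
    −a * −a * −a                     ≈⟨ *-cong (*-cong −a≈ −a≈) −a≈ ⟩
    (−1 * a) * (−1 * a) * (−1 * a)   ≡⟨ expand −1 a ⟩
    (−1 * −1 * −1) * c               ≈⟨ *-congʳ c −1*−1*−1≈−1 ⟩
    −1 * c                           ∎)
    where
    −a≈ = %-≈ (−1 * a)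
    expand : ∀ u a → (u * a) * (u * a) * (u * a) ≡ (u * u * u) * (a * a * a)
    expand = solve-∀

  τ₀-−a : τ₀ −a ≡ −a
  τ₀-−a = residue-≡ (m%n<n _ p) (m%n<n _ p) (begin
    τ₀ −a                                   ≈⟨ %-≈ _ ⟩
    −1 * (−a * −a * inverse a)              ≈⟨ *-congˡ −1 (*-congʳ (inverse a) (*-cong −a≈ −a≈)) ⟩
    −1 * ((−1 * a) * (−1 * a) * inverse a)  ≡⟨ collect −1 a (inverse a) ⟩
    (−1 * −1) * (−1 * a) * (a * inverse a)  ≈⟨ *-cong (*-congʳ (−1 * a) −1*−1≈1) a*a⁻¹≈1 ⟩
    1 * (−1 * a) * 1                        ≡⟨ trans (*-identityʳ _) (*-identityˡ _) ⟩
    −1 * a                                  ≈⟨ −a≈ ⟨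
    −a                                      ∎)
    where
    −a≈ = %-≈ (−1 * a)
    collect : ∀ u a i → u * ((u * a) * (u * a) * i) ≡ (u * u) * (u * a) * (a * i)
    collect = solve-∀

  module _ (2≉0 : 2 ≉ 0) where

    τ : ℕ × ℕ → ℕ × ℕ
    τ (x , y) = τ₀ x , y

    module τ = PrimePeriod _≟²_ τ

    τ-Invariant : τ.Invariant prime[2] roots
    τ-Invariant = record
      { unique   = filter⁺ negate.fixed? points-unique
      ; closed   = closed
      ; periodic = periodic
      }
      where
      closed : ∀ {z} → z ∈ roots → τ z ∈ roots
      closed {x , y} z∈ with ∈-roots⁻ 2≉0 z∈
      ... | refl , x<p , root = ∈-roots⁺ (m%n<n _ p) (τ₀-root {x} root)
      periodic : ∀ {z} → z ∈ roots → τ (τ z) ≡ z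
      periodic {x , y} z∈ with ∈-roots⁻ 2≉0 z∈
      ... | refl , x<p , root = cong (_, 0) (τ₀-involutive {x} root x<p)

    τ-fixed-length : length (filter τ.fixed? roots) ≡ 1
    τ-fixed-length = length-filter≡length τ.fixed? (τ.Invariant.unique τ-Invariant) ([] ∷ [])
      (λ { (here refl) → ∈-roots⁺ (m%n<n _ p) −a-root , cong (_, 0) τ₀-−a })
      only−a
      where
      only−a : ∀ {z} → z ∈ roots → τ z ≡ z → z ∈ (−a , 0) ∷ []
      only−a {x , y} z∈ τz≡z with ∈-roots⁻ 2≉0 z∈
      ... | refl , x<p , root = here (cong (_, 0) (τ₀-fixed⇒≡−a {x} root x<p (cong proj₁ τz≡z)))

    2∣N : 2 ∣ N p a
    2∣N = divides (1 + k + j)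
      (trans (cong suc (trans points≡ (cong (_+ j * 2) (trans roots≡ (cong (_+ k * 2) τ-fixed-length)))))
             (regroup k j))
      where
      negate-count = negate.length≡fixed+multiple prime[2] negate-Invariant
      τ-count = τ.length≡fixed+multiple prime[2] τ-Invariant
      j = proj₁ negate-count
      points≡ : length points ≡ length roots + j * 2
      points≡ = proj₂ negate-count
      k = proj₁ τ-count
      roots≡ : length roots ≡ length (filter τ.fixed? roots) + k * 2
      roots≡ = proj₂ τ-count
      regroup : ∀ k j → suc (1 + k * 2 + j * 2) ≡ (1 + k + j) * 2
      regroup = solve-∀

  module _ (ζ : CubeRootOfUnity) where

    open Rotation ζ

    private
      N≡1+axis+k*3 : ∃[ k ] N p a ≡ 1 + length axisPoints + k * 3
      N≡1+axis+k*3 = let k , points≡ = rotate.length≡fixed+multiple prime[3] rotate-Invariant in k , cong suc points≡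

    module _ (2≉0 : 2 ≉ 0) {b : ℕ} (b²≈a : b * b ≈ a) where

      private
        s = (a * b) % p
        t = (−1 * s) % p

        s²≈c : s * s ≈ c
        s²≈c = begin
          s * s              ≈⟨ *-cong (%-≈ (a * b)) (%-≈ (a * b)) ⟩
          (a * b) * (a * b)  ≡⟨ rearrange a b ⟩
          a * a * (b * b)    ≈⟨ *-congˡ (a * a) b²≈a ⟩
          a * a * a          ∎
          where
          rearrange : ∀ a b → (a * b) * (a * b) ≡ a * a * (b * b)
          rearrange = solve-∀

        t²≈c : t * t ≈ c
        t²≈c = begin
          t * t                ≈⟨ *-cong (%-≈ (−1 * s)) (%-≈ (−1 * s)) ⟩
          (−1 * s) * (−1 * s)  ≡⟨ rearrange −1 s ⟩
          (−1 * −1) * (s * s)  ≈⟨ *-cong −1*−1≈1 s²≈c ⟩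
          1 * c                ≡⟨ *-identityˡ c ⟩
          c                    ∎
          where
          rearrange : ∀ u s → (u * s) * (u * s) ≡ (u * u) * (s * s)
          rearrange = solve-∀

        s≢t : s ≢ t
        s≢t s≡t = *-≉0 a≉0 b≉0 (≈-trans (≈-sym (%-≈ (a * b))) s≈0)
          where
          b≉0 : b ≉ 0
          b≉0 b≈0 = a≉0 (≈-trans (≈-sym b²≈a) (*-cong b≈0 b≈0))
          s≈0 : s ≈ 0
          s≈0 = ≈−1*-self⇒≈0 2≉0 (≈-trans (≡⇒≈ s≡t) (%-≈ (−1 * s)))

        axisPoint≡± : ∀ {z} → z ∈ points → rotate z ≡ z → z ∈ (0 , s) ∷ (0 , t) ∷ []
        axisPoint≡± {x , y} z∈ fixed =
          [ (λ y≈s → here (cong₂ _,_ x≡0 (residue-≡ y<p (m%n<n (a * b) p) y≈s)))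
          , (λ y≈−s → there (here (cong₂ _,_ x≡0
                (residue-≡ y<p (m%n<n (−1 * s) p) (≈-trans y≈−s (≈-sym (%-≈ (−1 * s))))))))
          ]′ (square-roots {y} {s} (≈-trans y²≈c (≈-sym s²≈c)))
          where
          axis = ∈-axisPoints⁻ (∈-filter⁺ rotate.fixed? z∈ fixed)
          x≡0 = proj₁ axis
          y<p = proj₁ (proj₂ axis)
          y²≈c = proj₂ (proj₂ axis)

      length-axisPoints≡2 : length axisPoints ≡ 2
      length-axisPoints≡2 = length-filter≡length rotate.fixed? points-unique (((s≢t ∘ cong proj₂) ∷ []) ∷ [] ∷ [])
        (λ { (here refl)         → ∈-filter⁻ rotate.fixed? (∈-axisPoints⁺ (m%n<n _ p) s²≈c)
           ; (there (here refl)) → ∈-filter⁻ rotate.fixed? (∈-axisPoints⁺ (m%n<n _ p) t²≈c) })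
        axisPoint≡±

      QR⇒3∣N : 3 ∣ N p a
      QR⇒3∣N = divides (1 + k) (trans (proj₂ N≡1+axis+k*3) (cong (λ l → 1 + l + k * 3) length-axisPoints≡2))
        where k = proj₁ N≡1+axis+k*3

    axisPoint⇒QR : ∀ {z} → z ∈ axisPoints → ∃[ b ] b * b ≈ a
    axisPoint⇒QR {x , y} z∈ with ∈-axisPoints⁻ z∈
    ... | refl , _ , y²≈c = y * inverse a , (begin
      (y * inverse a) * (y * inverse a)        ≡⟨ rearrange₁ y (inverse a) ⟩
      (y * y) * (inverse a * inverse a)        ≈⟨ *-congʳ (inverse a * inverse a) y²≈c ⟩
      c * (inverse a * inverse a)              ≡⟨ rearrange₂ a (inverse a) ⟩
      a * ((a * inverse a) * (a * inverse a))  ≈⟨ *-congˡ a (*-cong a*a⁻¹≈1 a*a⁻¹≈1) ⟩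
      a * 1                                    ≡⟨ *-identityʳ a ⟩
      a                                        ∎)
      where
      rearrange₁ : ∀ y i → (y * i) * (y * i) ≡ (y * y) * (i * i)
      rearrange₁ = solve-∀
      rearrange₂ : ∀ a i → (a * a * a) * (i * i) ≡ a * ((a * i) * (a * i))
      rearrange₂ = solve-∀

    3∣N⇒QR : 3 ∣ N p a → ∃[ b ] b * b ≈ a
    3∣N⇒QR 3∣N = axisPoint⇒QR (proj₂ (∈-nonempty axis≢0))
      where
      k = proj₁ N≡1+axis+k*3
      axis≢0 : length axisPoints ≢ 0
      axis≢0 axis≡0 = n∤1+k*n k (s≤s (s≤s z≤n))
        (subst (3 ∣_) (trans (proj₂ N≡1+axis+k*3) (cong (λ l → 1 + l + k * 3) axis≡0)) 3∣N)

theorem13 : (p a : ℕ) → .{{_ : NonZero p}} → Prime p → p % 6 ≡ 1 →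
    a % p ≢ 0 →
    (IsQR p a → N p a % 6 ≡ 0) × (N p a % 6 ≡ 0 → IsQR p a)
theorem13 p a p-prime p%6≡1 a%p≢0 =
    (λ (_ , b , b²≈a) → 6∣⇒%6≡0 (lcm-least (2∣N p-prime a≉0 2≉0) (QR⇒3∣N p-prime a≉0 ζ 2≉0 {b} b²≈a)))
  , (λ N%6≡0 → a%p≢0 , 3∣N⇒QR p-prime a≉0 ζ (%6≡0⇒3∣ N%6≡0))
  where
  open PrimeField p-prime

  p%3≡1 : p % 3 ≡ 1
  p%3≡1 = p%6≡1⇒p%3≡1 {p} p%6≡1

  a≉0 : a ≉ 0
  a≉0 a≈0 = a%p≢0 (trans a≈0 0%p≡0)

  2≉0 : 2 ≉ 0
  2≉0 = residue-≉0 (s≤s z≤n) (≤∧≢⇒< 1<p 2≢p)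
    where
    2≢p : 2 ≢ p
    2≢p 2≡p with subst (λ q → q % 3 ≡ 1) (sym 2≡p) p%3≡1
    ... | ()

  ζ : CubeRootOfUnity
  ζ = cube-root-of-unity p-prime p%3≡1
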